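{- For every $\alpha,\beta>0$ and $h,s_1,s_2\in\mathbb N$ there exists $\gamma_0>0$ such that for every $0<\gamma\le\gamma_0$ there exists $n_0$ such that the following holds for all $n\ge n_0$. Let $H$ be an (ordered) graph on $h$ vertices, let $G$ be an (ordered) graph on $n$ vertices, let $x,y\in V(G)$ and $A\subseteq V(G)\setminus\{x,y\}$ with $|A|\geq \alpha n$. Suppose that for every $z\in A$ there exist at least $\beta n^{s_1h-1}$ sets $X\subseteq V(G)$ of size $s_1h-1$ such that both $G[X\cup\{x\}]$ and $G[X\cup\{z\}]$ contain perfect $H$-tilings, and at least $\beta n^{s_2h-1}$ sets $Y\subseteq V(G)$ of size $s_2h-1$ such that both $G[Y\cup\{y\}]$ and $G[Y\cup\{z\}]$ contain perfect $H$-tilings. Then there exist at least $\gamma n^{(s_1+s_2)h-1}$ sets $Z\subseteq V(G)$ of size $(s_1+s_2)h-1$ such that both $G[Z\cup\{x\}]$ and $G[Z\cup\{y\}]$ contain perfect $H$-tilings.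
   Context: The statement applies both to unordered graphs and to ordered graphs (graphs with vertex set $[n]$ where copies of $H$ must be embedded by order-preserving injections mapping edges to edges). An $H$-tiling is a collection of vertex-disjoint copies of $H$; perfect if it covers all vertices. $G[S]$ denotes the induced subgraph on $S$. The paper states the constants as a hierarchy $0<1/n\ll\gamma\ll\alpha,\beta,1/h,1/s_1,1/s_2$.
   Formalization: The constants α, β and γ range over the positive rationals, and the threshold γ₀ is taken in the positive rationals as well. -}

module Defs where

open import Data.Nat using (ℕ; _*_; _∸_; _^_)
open import Data.Fin using (Fin; _<_)
open import Data.Fin.Subset using (Subset; _∈_; _∉_; _∪_; ⁅_⁆; ∣_∣)
open import Data.Bool using (Bool; true; false)
open import Data.Product using (Σ; _×_; ∃)
open import Data.List using (List; length)
open import Data.List.Relation.Unary.All using (All)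
open import Data.List.Relation.Unary.Unique.Propositional using (Unique)
open import Data.Integer using (+_)
open import Data.Rational using (ℚ; _/_; _≤_)
import Data.Rational as ℚ
open import Relation.Binary.PropositionalEquality using (_≡_; _≢_)
open import Relation.Nullary using (¬_)

-- A (simple) graph on vertex set Fin n: symmetric irreflexive adjacency.
-- An ordered graph is the same object, its vertex order being that of Fin n.
record Graph (n : ℕ) : Set₁ where
  field
    Adj   : Fin n → Fin n → Set
    sym   : ∀ {u v} → Adj u v → Adj v u
    irrefl : ∀ {u} → ¬ Adj u u

open Graph public

-- Admissible vertex maps for copies of H:
-- unordered setting (false): injective; ordered setting (true): order-preserving injective.
Admissible : Bool → {h n : ℕ} → (Fin h → Fin n) → Set
Admissible false φ = ∀ a b → φ a ≡ φ b → a ≡ b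
Admissible true  φ = ∀ a b → a < b → φ a < φ b

IsCopy : Bool → {h n : ℕ} → Graph h → Graph n → (Fin h → Fin n) → Set
IsCopy ord H G φ = Admissible ord φ × (∀ a b → Adj H a b → Adj G (φ a) (φ b))

HasPerfectTiling : Bool → {h n : ℕ} → Graph h → Graph n → Subset n → Set
HasPerfectTiling ord {h} {n} H G S =
  Σ ℕ λ m → Σ (Fin m → Fin h → Fin n) λ φ →
    (∀ i → IsCopy ord H G (φ i))
    × (∀ i j a b → φ i a ≡ φ j b → (i ≡ j × a ≡ b))
    × (∀ i a → φ i a ∈ S)
    × (∀ v → v ∈ S → Σ (Fin m) λ i → Σ (Fin h) λ a → φ i a ≡ v)

AtLeastSets : {n : ℕ} → ℕ → ℕ → (Subset n → Set) → Set
AtLeastSets {n} N k P =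
  Σ (List (Subset n)) λ L →
    Unique L × All (λ Z → ∣ Z ∣ ≡ k × P Z) L × N Data.Nat.≤ length L

ℕ→ℚ : ℕ → ℚ
ℕ→ℚ k = + k / 1

AtLeastℚ : {n : ℕ} → ℚ → ℕ → (Subset n → Set) → Set
AtLeastℚ q k P = Σ ℕ λ N → (q ≤ ℕ→ℚ N) × AtLeastSets N k P

Absorbs : Bool → {h n : ℕ} → Graph h → Graph n → Fin n → Fin n → Subset n → Set
Absorbs ord H G u w Z =
  HasPerfectTiling ord H G (Z ∪ ⁅ u ⁆) × HasPerfectTiling ord H G (Z ∪ ⁅ w ⁆)

-- Let a = s₁h − 1, b = s₂h − 1, and α ≥ 1/Q, β ≥ 1/R. Fix z ∈ A. Discard the (x,z)-absorbers X
-- that meet {y, z} and, for each remaining X, the (y,z)-absorbers Y that meet X ∪ {x, z}. A vertex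
-- lies in at most n^(k−1) of the k-subsets of [n], so for n ≥ 2R(a + 2) at least half of each
-- family survives. For a surviving triple, Z = X ∪ Y ∪ {z} has size a + b + 1 and absorbs x and y:
-- G[Z ∪ {x}] is tiled by the tilings of G[X ∪ {x}] and G[Y ∪ {z}], and G[Z ∪ {y}] by those of
-- G[X ∪ {z}] and G[Y ∪ {y}]. Summing over z ∈ A gives at least |A| n^(a+b) / (2R)² ≥
-- n^(a+b+1) / (Q (2R)²) triples, and a set Z arises from at most 8^|Z| of them.
module Submission where

open import Defs using (Graph; IsCopy; HasPerfectTiling; Absorbs; AtLeastℚ; ℕ→ℚ)
open import Data.Bool using (Bool; true; false)
import Data.Bool.Properties as Boolₚ
open import Data.Empty using (⊥; ⊥-elim)
open import Data.Fin using (Fin; zero; suc; splitAt; join; _↑ˡ_; _↑ʳ_)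
import Data.Fin.Properties as Finₚ
open import Data.Fin.Subset using (Subset; _∈_; _∉_; _⊆_; _∪_; ⁅_⁆; ∣_∣)
import Data.Fin.Subset.Properties as Subsetₚ
import Data.Integer as ℤ
import Data.Integer.Properties as ℤₚ
open import Data.List using (List; []; _∷_; length; map; filter; concatMap; deduplicate)
open import Data.List.Properties using (length-++; length-map; filter-all)
open import Data.List.Membership.Propositional using () renaming (_∈_ to _∈ₗ_)
open import Data.List.Membership.Propositional.Properties using (∈-map⁺; ∈-map⁻; ∈-deduplicate⁺)
open import Data.List.Relation.Unary.All as All using (All; []; _∷_)
import Data.List.Relation.Unary.All.Properties as Allₚ
open import Data.List.Relation.Unary.Any as Any using (Any; here; there)
open import Data.List.Relation.Unary.Unique.Propositional using (Unique)
import Data.List.Relation.Unary.Unique.Propositional.Properties as Uniqueₚ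
import Data.List.Relation.Unary.Unique.DecPropositional.Properties as DecUniqueₚ
open import Data.List.Relation.Unary.AllPairs as AllPairs using ([]; _∷_)
import Data.List.Relation.Unary.AllPairs.Properties as AllPairsₚ
open import Data.Nat as ℕ using (ℕ; zero; suc; z≤n; s≤s; _+_; _*_; _^_; _∸_)
import Data.Nat.Properties as ℕₚ
open import Data.Nat.Coprimality using (Coprime; 1-coprimeTo) renaming (sym to coprime-sym)
open import Data.Product using (Σ; ∃; _×_; _,_; proj₁; proj₂)
open import Data.Rational as ℚ using (ℚ; mkℚ; 0ℚ; _≤_; _<_; *<*)
import Data.Rational.Properties as ℚₚ
import Data.Rational.Unnormalised as ℚᵘ
import Data.Rational.Unnormalised.Properties as ℚᵘₚ
open import Data.Sum using (_⊎_; inj₁; inj₂)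
open import Data.Vec using ([]; _∷_; _++_; here; there)
import Data.Vec.Properties as Vecₚ
open import Function using (_∘_)
open import Function.Bundles using (_⇔_; mk⇔; module Equivalence)
open import Relation.Binary.Definitions using (DecidableEquality)
open import Relation.Binary.PropositionalEquality
  using (_≡_; _≢_; refl; cong; cong₂; sym; trans; subst; subst₂; module ≡-Reasoning)
open import Relation.Nullary using (Dec; yes; no; ¬_; ¬?; contradiction)
open import Relation.Nullary.Decidable using (decidable-stable)
open import Relation.Unary using (Decidable)
open import Relation.Unary.Properties using (∁?)

private
  variable
    A B : Set
    n : ℕ

dependentProduct : List A → (A → List B) → List (A × B)
dependentProduct xs g = concatMap (λ a → map (a ,_) (g a)) xs

module _ {xs : List A} {g : A → List B} where

  dependentProduct⁺ : ∀ {P : A × B → Set} → All (λ a → All (λ b → P (a , b)) (g a)) xs →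
                      All P (dependentProduct xs g)
  dependentProduct⁺ = Allₚ.concat⁺ ∘ Allₚ.map⁺ ∘ All.map Allₚ.map⁺

  unique-dependentProduct : Unique xs → All (Unique ∘ g) xs → Unique (dependentProduct xs g)
  unique-dependentProduct xs! g! =
    Uniqueₚ.concat⁺ (Allₚ.map⁺ (All.map (Uniqueₚ.map⁺ (cong proj₂)) g!))
                    (AllPairsₚ.map⁺ (AllPairs.map disjoint xs!))
    where
    first : ∀ {a t} → t ∈ₗ map (a ,_) (g a) → proj₁ t ≡ a
    first t∈ with ∈-map⁻ (_ ,_) t∈
    ... | _ , _ , refl = refl
    disjoint : ∀ {a a′} → a ≢ a′ → ∀ {t} → ¬ (t ∈ₗ map (a ,_) (g a) × t ∈ₗ map (a′ ,_) (g a′))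
    disjoint a≢a′ (t∈ , t∈′) = a≢a′ (trans (sym (first t∈)) (first t∈′))

length-dependentProduct : ∀ (xs : List A) (g : A → List B) {m} d →
  All (λ a → m ℕ.≤ d * length (g a)) xs → length xs * m ℕ.≤ d * length (dependentProduct xs g)
length-dependentProduct [] g d [] = z≤n
length-dependentProduct (a ∷ xs) g {m} d (m≤ ∷ ms≤) = begin
  m + length xs * m                             ≤⟨ ℕₚ.+-mono-≤ m≤ (length-dependentProduct xs g d ms≤) ⟩
  d * length (g a) + d * length rest            ≡⟨ sym (ℕₚ.*-distribˡ-+ d (length (g a)) _) ⟩
  d * (length (g a) + length rest)              ≡⟨ cong (λ k → d * (k + _)) (sym (length-map (a ,_) (g a))) ⟩
  d * (length (map (a ,_) (g a)) + length rest) ≡⟨ cong (d *_) (sym (length-++ (map (a ,_) (g a)))) ⟩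
  d * length (dependentProduct (a ∷ xs) g)      ∎
  where
  open ℕₚ.≤-Reasoning
  rest = dependentProduct xs g

length-filter-∁ : ∀ {P : A → Set} (P? : Decidable P) xs →
                  length xs ℕ.≤ length (filter P? xs) + length (filter (∁? P?) xs)
length-filter-∁ P? [] = z≤n
length-filter-∁ P? (x ∷ xs) with P? x
... | yes _ = s≤s (length-filter-∁ P? xs)
... | no _ = ℕₚ.≤-trans (s≤s (length-filter-∁ P? xs)) (ℕₚ.≤-reflexive (sym (ℕₚ.+-suc _ _)))

module _ {R : A → B → Set} (R? : ∀ x b → Dec (R x b)) {P : A → Set} {M : ℕ}
         (fibre : ∀ b {ys} → Unique ys → All P ys → All (λ y → R y b) ys → length ys ℕ.≤ M) where

  length-≤-cover : ∀ bs {xs} → Unique xs → All P xs → All (λ x → Any (R x) bs) xs →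
                   length xs ℕ.≤ length bs * M
  length-≤-cover [] {[]} _ _ _ = z≤n
  length-≤-cover [] {_ ∷ _} _ _ (() ∷ _)
  length-≤-cover (b ∷ bs) {xs} xs! Pxs covered = begin
    length xs                                             ≤⟨ length-filter-∁ Rb? xs ⟩
    length (filter Rb? xs) + length (filter (∁? Rb?) xs) ≤⟨ ℕₚ.+-mono-≤ inFibre rest ⟩
    M + length bs * M                                     ∎
    where
    open ℕₚ.≤-Reasoning
    Rb? : Decidable (λ x → R x b)
    Rb? x = R? x b
    inFibre = fibre b (Uniqueₚ.filter⁺ Rb? xs!) (Allₚ.filter⁺ Rb? Pxs) (Allₚ.all-filter Rb? xs)
    rest = length-≤-cover bs (Uniqueₚ.filter⁺ (∁? Rb?) xs!) (Allₚ.filter⁺ (∁? Rb?) Pxs)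
             (All.map (λ { (here r , ¬r) → ⊥-elim (¬r r) ; (there c , _) → c })
                      (All.zip (Allₚ.filter⁺ (∁? Rb?) covered , Allₚ.all-filter (∁? Rb?) xs)))

length-All-⊥ : ∀ {xs : List A} → All (λ _ → ⊥) xs → length xs ℕ.≤ 0
length-All-⊥ [] = z≤n

length-unique-subsingleton : (∀ (a b : A) → a ≡ b) → ∀ {xs} → Unique xs → length xs ℕ.≤ 1
length-unique-subsingleton _ {[]} _ = z≤n
length-unique-subsingleton _ {_ ∷ []} _ = s≤s z≤n
length-unique-subsingleton eq {a ∷ b ∷ _} ((a≢b ∷ _) ∷ _) = contradiction (eq a b) a≢b

choose : ∀ {I : Set} {Q : I → Set} {P : I → B → Set} → Decidable Q → B →
         (∀ i → Q i → Σ B (P i)) → Σ (I → B) λ f → ∀ {i} → Q i → P i (f i)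
choose {I = I} {Q} {P} Q? default pick = f , f-spec
  where
  f : I → _
  f i with Q? i
  ... | yes q = proj₁ (pick i q)
  ... | no _ = default
  f-spec : ∀ {i} → Q i → P i (f i)
  f-spec {i} q with Q? i
  ... | yes q′ = proj₂ (pick i q′)
  ... | no ¬q = contradiction q ¬q

-- Counting subsets of Fin n

Subset0-irrelevant : ∀ (p q : Subset 0) → p ≡ q
Subset0-irrelevant [] [] = refl

∈⇒∣p∣≢0 : ∀ {v} {p : Subset n} → v ∈ p → ∣ p ∣ ≢ 0
∈⇒∣p∣≢0 {v = v} {p} v∈p ∣p∣≡0 = contradiction (begin
    1         ≡⟨ sym (Subsetₚ.∣⁅x⁆∣≡1 v) ⟩
    ∣ ⁅ v ⁆ ∣ ≤⟨ Subsetₚ.p⊆q⇒∣p∣≤∣q∣ ⁅v⁆⊆p ⟩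
    ∣ p ∣     ≡⟨ ∣p∣≡0 ⟩
    0         ∎) λ ()
  where
  open ℕₚ.≤-Reasoning
  ⁅v⁆⊆p : ⁅ v ⁆ ⊆ p
  ⁅v⁆⊆p u∈⁅v⁆ = subst (_∈ p) (sym (Subsetₚ.x∈⁅y⁆⇒x≡y v u∈⁅v⁆)) v∈p

m^j+m^[1+j]≤[1+m]^[1+j] : ∀ m j → m ^ j + m ^ suc j ℕ.≤ suc m ^ suc j
m^j+m^[1+j]≤[1+m]^[1+j] m j = ℕₚ.*-monoʳ-≤ (suc m) (ℕₚ.^-monoˡ-≤ j (ℕₚ.n≤1+n m))

withHead : Bool → List (Subset (suc n)) → List (Subset n)
withHead b [] = []
withHead b ((c ∷ p) ∷ L) with b Boolₚ.≟ c
... | yes _ = p ∷ withHead b L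
... | no _ = withHead b L

module _ {n : ℕ} (b : Bool) where

  withHead⁺ : ∀ {P : Subset (suc n) → Set} {L} → All P L → All (λ p → P (b ∷ p)) (withHead b L)
  withHead⁺ {L = []} [] = []
  withHead⁺ {L = (c ∷ p) ∷ L} (Pcp ∷ PL) with b Boolₚ.≟ c
  ... | yes refl = Pcp ∷ withHead⁺ PL
  ... | no _ = withHead⁺ PL

  unique-withHead : ∀ {L : List (Subset (suc n))} → Unique L → Unique (withHead b L)
  unique-withHead {[]} [] = []
  unique-withHead {(c ∷ p) ∷ L} (cp∉L ∷ L!) with b Boolₚ.≟ c
  ... | yes refl = All.map (λ b∷p≢ p≡ → b∷p≢ (cong (b ∷_) p≡)) (withHead⁺ cp∉L) ∷ unique-withHead L!
  ... | no _ = unique-withHead L!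

length-withHead : ∀ (L : List (Subset (suc n))) →
                  length L ℕ.≤ length (withHead true L) + length (withHead false L)
length-withHead [] = z≤n
length-withHead ((true ∷ p) ∷ L) = s≤s (length-withHead L)
length-withHead ((false ∷ p) ∷ L) =
  ℕₚ.≤-trans (s≤s (length-withHead L)) (ℕₚ.≤-reflexive (sym (ℕₚ.+-suc _ _)))

length-≤-withHeads : ∀ (L : List (Subset (suc n))) {t f} →
  length (withHead true L) ℕ.≤ t → length (withHead false L) ℕ.≤ f → length L ℕ.≤ t + f
length-≤-withHeads L t≤ f≤ = ℕₚ.≤-trans (length-withHead L) (ℕₚ.+-mono-≤ t≤ f≤)

length-subsetsOfSize : ∀ {n} k {L : List (Subset n)} → Unique L → All (λ X → ∣ X ∣ ≡ k) L →
                       length L ℕ.≤ n ^ k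
length-subsetsOfSize {zero} zero L! _ = length-unique-subsingleton Subset0-irrelevant L!
length-subsetsOfSize {zero} (suc k) {[]} _ _ = z≤n
length-subsetsOfSize {zero} (suc k) {[] ∷ _} _ (() ∷ _)
length-subsetsOfSize {suc n} zero {L} L! sizes = length-≤-withHeads L
  (length-All-⊥ (All.map (λ ()) (withHead⁺ true sizes)))
  (length-subsetsOfSize zero (unique-withHead false L!) (withHead⁺ false sizes))
length-subsetsOfSize {suc n} (suc k) {L} L! sizes = ℕₚ.≤-trans (length-≤-withHeads L
  (length-subsetsOfSize k (unique-withHead true L!) (All.map ℕₚ.suc-injective (withHead⁺ true sizes)))
  (length-subsetsOfSize (suc k) (unique-withHead false L!) (withHead⁺ false sizes)))
  (m^j+m^[1+j]≤[1+m]^[1+j] n k)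

length-containing : ∀ {n} j (v : Fin n) {L : List (Subset n)} → Unique L →
                    All (λ X → ∣ X ∣ ≡ suc j × v ∈ X) L → length L ℕ.≤ n ^ j
length-containing {suc n} j zero {L} L! sets = begin
  length L  ≤⟨ length-≤-withHeads L tails (length-All-⊥ (All.map (λ { (_ , ()) }) (withHead⁺ false sets))) ⟩
  n ^ j + 0 ≡⟨ ℕₚ.+-identityʳ _ ⟩
  n ^ j     ≤⟨ ℕₚ.^-monoˡ-≤ j (ℕₚ.n≤1+n n) ⟩
  suc n ^ j ∎
  where
  open ℕₚ.≤-Reasoning
  tails = length-subsetsOfSize j (unique-withHead true L!)
            (All.map (ℕₚ.suc-injective ∘ proj₁) (withHead⁺ true sets))
length-containing {suc n} zero (suc v) {L} L! sets = length-≤-withHeads L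
  (length-All-⊥ (All.map (λ (∣X∣≡ , v∈) → ∈⇒∣p∣≢0 (Subsetₚ.drop-there v∈) (ℕₚ.suc-injective ∣X∣≡))
                         (withHead⁺ true sets)))
  (length-containing zero v (unique-withHead false L!)
    (All.map (λ (∣X∣≡ , v∈) → ∣X∣≡ , Subsetₚ.drop-there v∈) (withHead⁺ false sets)))
length-containing {suc n} (suc j) (suc v) {L} L! sets = ℕₚ.≤-trans (length-≤-withHeads L
  (length-containing j v (unique-withHead true L!)
    (All.map (λ (∣X∣≡ , v∈) → ℕₚ.suc-injective ∣X∣≡ , Subsetₚ.drop-there v∈) (withHead⁺ true sets)))
  (length-containing (suc j) v (unique-withHead false L!)
    (All.map (λ (∣X∣≡ , v∈) → ∣X∣≡ , Subsetₚ.drop-there v∈) (withHead⁺ false sets))))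
  (m^j+m^[1+j]≤[1+m]^[1+j] n j)

length-subsets : ∀ (S : Subset n) {L} → Unique L → All (_⊆ S) L → length L ℕ.≤ 2 ^ ∣ S ∣
length-subsets [] L! _ = length-unique-subsingleton Subset0-irrelevant L!
length-subsets (true ∷ S) {L} L! L⊆ = ℕₚ.≤-trans (length-≤-withHeads L (half true) (half false))
  (ℕₚ.≤-reflexive (cong (2 ^ ∣ S ∣ +_) (sym (ℕₚ.+-identityʳ _))))
  where
  half : ∀ b → length (withHead b L) ℕ.≤ 2 ^ ∣ S ∣
  half b = length-subsets S (unique-withHead b L!) (All.map Subsetₚ.drop-∷-⊆ (withHead⁺ b L⊆))
length-subsets (false ∷ S) {L} L! L⊆ = length-≤-withHeads L
  (length-All-⊥ (All.map (λ ⊆S → zero∉ (⊆S here)) (withHead⁺ true L⊆)))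
  (length-subsets S (unique-withHead false L!) (All.map Subsetₚ.drop-∷-⊆ (withHead⁺ false L⊆)))
  where
  zero∉ : zero ∉ false ∷ S
  zero∉ ()

-- Disjoint unions of subsets

Disjoint : Subset n → Subset n → Set
Disjoint p q = ∀ {v} → v ∈ p → v ∉ q

Disjoint-tail : ∀ {s t} {p q : Subset n} → Disjoint (s ∷ p) (t ∷ q) → Disjoint p q
Disjoint-tail disj v∈p v∈q = disj (there v∈p) (there v∈q)

∣p∪q∣≡∣p∣+∣q∣ : ∀ (p q : Subset n) → Disjoint p q → ∣ p ∪ q ∣ ≡ ∣ p ∣ + ∣ q ∣
∣p∪q∣≡∣p∣+∣q∣ [] [] _ = refl
∣p∪q∣≡∣p∣+∣q∣ (true ∷ p) (true ∷ q) disj = ⊥-elim (disj here here)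
∣p∪q∣≡∣p∣+∣q∣ (true ∷ p) (false ∷ q) disj = cong suc (∣p∪q∣≡∣p∣+∣q∣ p q (Disjoint-tail disj))
∣p∪q∣≡∣p∣+∣q∣ (false ∷ p) (true ∷ q) disj =
  trans (cong suc (∣p∪q∣≡∣p∣+∣q∣ p q (Disjoint-tail disj))) (sym (ℕₚ.+-suc ∣ p ∣ ∣ q ∣))
∣p∪q∣≡∣p∣+∣q∣ (false ∷ p) (false ∷ q) disj = ∣p∪q∣≡∣p∣+∣q∣ p q (Disjoint-tail disj)

∣p++q∣≡∣p∣+∣q∣ : ∀ {m n} (p : Subset m) (q : Subset n) → ∣ p ++ q ∣ ≡ ∣ p ∣ + ∣ q ∣
∣p++q∣≡∣p∣+∣q∣ [] q = refl
∣p++q∣≡∣p∣+∣q∣ (true ∷ p) q = cong suc (∣p++q∣≡∣p∣+∣q∣ p q)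
∣p++q∣≡∣p∣+∣q∣ (false ∷ p) q = ∣p++q∣≡∣p∣+∣q∣ p q

++-mono-⊆ : ∀ {m n} {p p′ : Subset m} {q q′ : Subset n} → p ⊆ p′ → q ⊆ q′ → p ++ q ⊆ p′ ++ q′
++-mono-⊆ {p = []} {[]} _ q⊆q′ v∈ = q⊆q′ v∈
++-mono-⊆ {p = true ∷ _} {true ∷ _} p⊆p′ q⊆q′ here = here
++-mono-⊆ {p = true ∷ _} {false ∷ _} p⊆p′ q⊆q′ here with p⊆p′ here
... | ()
++-mono-⊆ {p = _ ∷ _} {_ ∷ _} p⊆p′ q⊆q′ (there v∈) = there (++-mono-⊆ (Subsetₚ.drop-∷-⊆ p⊆p′) q⊆q′ v∈)

⁅⁆-injective : ∀ {x y : Fin n} → ⁅ x ⁆ ≡ ⁅ y ⁆ → x ≡ y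
⁅⁆-injective {x = x} {y} eq = Subsetₚ.x∈⁅y⁆⇒x≡y y (subst (x ∈_) eq (Subsetₚ.x∈⁅x⁆ x))

module _ {X Y Z : Subset n} where

  Disjoint-∪ˡ : Disjoint X Z → Disjoint Y Z → Disjoint (X ∪ Y) Z
  Disjoint-∪ˡ X∩Z Y∩Z v∈ with Subsetₚ.x∈p∪q⁻ X Y v∈
  ... | inj₁ v∈X = X∩Z v∈X
  ... | inj₂ v∈Y = Y∩Z v∈Y

  Disjoint-∪ʳ : Disjoint X Y → Disjoint X Z → Disjoint X (Y ∪ Z)
  Disjoint-∪ʳ X∩Y X∩Z v∈X v∈ with Subsetₚ.x∈p∪q⁻ Y Z v∈
  ... | inj₁ v∈Y = X∩Y v∈X v∈Y
  ... | inj₂ v∈Z = X∩Z v∈X v∈Z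

module _ {X : Subset n} {v : Fin n} where

  Disjoint-⁅⁆ʳ : v ∉ X → Disjoint X ⁅ v ⁆
  Disjoint-⁅⁆ʳ v∉X u∈X u∈⁅v⁆ = v∉X (subst (_∈ X) (Subsetₚ.x∈⁅y⁆⇒x≡y v u∈⁅v⁆) u∈X)

  Disjoint-⁅⁆ˡ : v ∉ X → Disjoint ⁅ v ⁆ X
  Disjoint-⁅⁆ˡ v∉X u∈⁅v⁆ = v∉X ∘ subst (_∈ X) (Subsetₚ.x∈⁅y⁆⇒x≡y v u∈⁅v⁆)

Disjoint-⁅⁆⁅⁆ : ∀ {v w : Fin n} → v ≢ w → Disjoint ⁅ v ⁆ ⁅ w ⁆
Disjoint-⁅⁆⁅⁆ {v = v} {w} v≢w u∈⁅v⁆ u∈⁅w⁆ =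
  v≢w (trans (sym (Subsetₚ.x∈⁅y⁆⇒x≡y v u∈⁅v⁆)) (Subsetₚ.x∈⁅y⁆⇒x≡y w u∈⁅w⁆))

module _ {n : ℕ} where
  open import Algebra.Solver.IdempotentCommutativeMonoid (Subsetₚ.∪-idempotentCommutativeMonoid n)

  [X∪Y∪u]∪w≡[X∪w]∪[Y∪u] : ∀ (X Y u w : Subset n) → ((X ∪ Y) ∪ u) ∪ w ≡ (X ∪ w) ∪ (Y ∪ u)
  [X∪Y∪u]∪w≡[X∪w]∪[Y∪u] = solve 4 (λ X Y u w → ((X ⊕ Y) ⊕ u) ⊕ w ⊜ (X ⊕ w) ⊕ (Y ⊕ u)) refl

  [X∪Y∪u]∪w≡[X∪u]∪[Y∪w] : ∀ (X Y u w : Subset n) → ((X ∪ Y) ∪ u) ∪ w ≡ (X ∪ u) ∪ (Y ∪ w)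
  [X∪Y∪u]∪w≡[X∪u]∪[Y∪w] = solve 4 (λ X Y u w → ((X ⊕ Y) ⊕ u) ⊕ w ⊜ (X ⊕ u) ⊕ (Y ⊕ w)) refl

elements : Subset n → List (Fin n)
elements [] = []
elements (true ∷ p) = zero ∷ map suc (elements p)
elements (false ∷ p) = map suc (elements p)

length-elements : ∀ (p : Subset n) → length (elements p) ≡ ∣ p ∣
length-elements [] = refl
length-elements (true ∷ p) = cong suc (trans (length-map suc (elements p)) (length-elements p))
length-elements (false ∷ p) = trans (length-map suc (elements p)) (length-elements p)

unique-elements : ∀ (p : Subset n) → Unique (elements p)
unique-elements [] = []
unique-elements (true ∷ p) =
  Allₚ.map⁺ (All.universal (λ _ ()) _) ∷ Uniqueₚ.map⁺ Finₚ.suc-injective (unique-elements p)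
unique-elements (false ∷ p) = Uniqueₚ.map⁺ Finₚ.suc-injective (unique-elements p)

elements⊆ : ∀ (p : Subset n) → All (_∈ p) (elements p)
elements⊆ [] = []
elements⊆ (true ∷ p) = here ∷ Allₚ.map⁺ (All.map there (elements⊆ p))
elements⊆ (false ∷ p) = Allₚ.map⁺ (All.map there (elements⊆ p))

∈-elements : ∀ {p : Subset n} {v} → v ∈ p → v ∈ₗ elements p
∈-elements {p = true ∷ p} here = here refl
∈-elements {p = true ∷ p} (there v∈p) = there (∈-map⁺ suc (∈-elements v∈p))
∈-elements {p = false ∷ p} (there v∈p) = ∈-map⁺ suc (∈-elements v∈p)

tiling-∪ : ∀ {ord h n} (H : Graph h) (G : Graph n) {S₁ S₂ : Subset n} → Disjoint S₁ S₂ →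
           HasPerfectTiling ord H G S₁ → HasPerfectTiling ord H G S₂ → HasPerfectTiling ord H G (S₁ ∪ S₂)
tiling-∪ {ord} {h} {n} H G {S₁} {S₂} disj
  (m₁ , φ₁ , copy₁ , inj₁′ , in₁ , cover₁) (m₂ , φ₂ , copy₂ , inj₂′ , in₂ , cover₂) =
  m₁ + m₂ , φ , (λ i → copy (splitAt m₁ i)) , injective , (λ i → inside (splitAt m₁ i)) , covers
  where
  ψ : Fin m₁ ⊎ Fin m₂ → Fin h → Fin n
  ψ (inj₁ i) = φ₁ i
  ψ (inj₂ j) = φ₂ j
  φ : Fin (m₁ + m₂) → Fin h → Fin n
  φ i = ψ (splitAt m₁ i)
  copy : ∀ s → IsCopy ord H G (ψ s)
  copy (inj₁ i) = copy₁ i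
  copy (inj₂ j) = copy₂ j
  inside : ∀ s a → ψ s a ∈ S₁ ∪ S₂
  inside (inj₁ i) a = Subsetₚ.x∈p∪q⁺ (inj₁ (in₁ i a))
  inside (inj₂ j) a = Subsetₚ.x∈p∪q⁺ (inj₂ (in₂ j a))
  ψ-injective : ∀ s t a b → ψ s a ≡ ψ t b → s ≡ t × a ≡ b
  ψ-injective (inj₁ i) (inj₁ j) a b eq with inj₁′ i j a b eq
  ... | refl , a≡b = refl , a≡b
  ψ-injective (inj₂ i) (inj₂ j) a b eq with inj₂′ i j a b eq
  ... | refl , a≡b = refl , a≡b
  ψ-injective (inj₁ i) (inj₂ j) a b eq = ⊥-elim (disj (in₁ i a) (subst (_∈ S₂) (sym eq) (in₂ j b)))
  ψ-injective (inj₂ i) (inj₁ j) a b eq = ⊥-elim (disj (in₁ j b) (subst (_∈ S₂) eq (in₂ i a)))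
  splitAt-injective : ∀ {i j} → splitAt m₁ i ≡ splitAt m₁ j → i ≡ j
  splitAt-injective {i} {j} split≡ =
    trans (sym (Finₚ.join-splitAt m₁ m₂ i)) (trans (cong (join m₁ m₂) split≡) (Finₚ.join-splitAt m₁ m₂ j))
  injective : ∀ i j a b → φ i a ≡ φ j b → i ≡ j × a ≡ b
  injective i j a b eq with ψ-injective (splitAt m₁ i) (splitAt m₁ j) a b eq
  ... | split≡ , a≡b = splitAt-injective split≡ , a≡b
  covers : ∀ v → v ∈ S₁ ∪ S₂ → Σ (Fin (m₁ + m₂)) λ i → Σ (Fin h) λ a → φ i a ≡ v
  covers v v∈ with Subsetₚ.x∈p∪q⁻ S₁ S₂ v∈
  ... | inj₁ v∈S₁ with cover₁ v v∈S₁
  ... | i , a , eq = i ↑ˡ m₂ , a , trans (cong (λ s → ψ s a) (Finₚ.splitAt-↑ˡ m₁ i m₂)) eq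
  covers v v∈ | inj₂ v∈S₂ with cover₂ v v∈S₂
  ... | j , a , eq = m₁ ↑ʳ j , a , trans (cong (λ s → ψ s a) (Finₚ.splitAt-↑ʳ m₁ m₂ j)) eq

-- Absorbers

m≤r[g+e]∧2re≤m⇒m≤2rg : ∀ {m} r {g e} → m ℕ.≤ r * (g + e) → 2 * r * e ℕ.≤ m → m ℕ.≤ 2 * r * g
m≤r[g+e]∧2re≤m⇒m≤2rg {m} r {g} {e} m≤ 2re≤m = ℕₚ.+-cancelʳ-≤ m m (2 * r * g) (begin
  m + m                     ≡⟨ cong (m +_) (sym (ℕₚ.+-identityʳ m)) ⟩
  2 * m                     ≤⟨ ℕₚ.*-monoʳ-≤ 2 m≤ ⟩
  2 * (r * (g + e))         ≡⟨ sym (ℕₚ.*-assoc 2 r (g + e)) ⟩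
  2 * r * (g + e)           ≡⟨ ℕₚ.*-distribˡ-+ (2 * r) g e ⟩
  2 * r * g + 2 * r * e     ≤⟨ ℕₚ.+-monoʳ-≤ (2 * r * g) 2re≤m ⟩
  2 * r * g + m             ∎)
  where open ℕₚ.≤-Reasoning

Avoids : List (Fin n) → Subset n → Set
Avoids vs X = All (_∉ X) vs

avoids? : ∀ (vs : List (Fin n)) → Decidable (Avoids vs)
avoids? vs X = All.all? (λ v → ¬? (v Subsetₚ.∈? X)) vs

avoiding : List (Fin n) → List (Subset n) → List (Subset n)
avoiding vs = filter (avoids? vs)

avoiding⁺ : ∀ {P : Subset n → Set} vs {L} → All P L → All (λ X → P X × Avoids vs X) (avoiding vs L)
avoiding⁺ vs {L} PL = All.zip (Allₚ.filter⁺ (avoids? vs) PL , Allₚ.all-filter (avoids? vs) L)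

length-avoiding : ∀ {k} R (vs : List (Fin n)) {L : List (Subset n)} → Unique L → All (λ X → ∣ X ∣ ≡ k) L →
                  n ^ k ℕ.≤ R * length L → 2 * R * length vs ℕ.≤ n → n ^ k ℕ.≤ 2 * R * length (avoiding vs L)
length-avoiding {k = zero} R vs {L} _ sizes large _ = begin
  1                              ≤⟨ large ⟩
  R * length L                   ≤⟨ ℕₚ.*-monoˡ-≤ (length L) (ℕₚ.m≤n*m R 2) ⟩
  2 * R * length L               ≡⟨ cong (λ L′ → 2 * R * length L′) (sym (filter-all (avoids? vs) avoided)) ⟩
  2 * R * length (avoiding vs L) ∎
  where
  open ℕₚ.≤-Reasoning
  avoided : All (Avoids vs) L
  avoided = All.map (λ ∣X∣≡0 → All.universal (λ _ v∈X → ∈⇒∣p∣≢0 v∈X ∣X∣≡0) vs) sizes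
length-avoiding {n = n} {k = suc j} R vs {L} L! sizes large small =
  m≤r[g+e]∧2re≤m⇒m≤2rg R (ℕₚ.≤-trans large (ℕₚ.*-monoʳ-≤ R (length-filter-∁ (avoids? vs) L))) (begin
    2 * R * length removed         ≤⟨ ℕₚ.*-monoʳ-≤ (2 * R) removed≤ ⟩
    2 * R * (length vs * n ^ j)    ≡⟨ sym (ℕₚ.*-assoc (2 * R) (length vs) (n ^ j)) ⟩
    2 * R * length vs * n ^ j      ≤⟨ ℕₚ.*-monoˡ-≤ (n ^ j) small ⟩
    n ^ suc j                      ∎)
  where
  open ℕₚ.≤-Reasoning
  removed = filter (∁? (avoids? vs)) L
  meets : ∀ {X} → ¬ Avoids vs X → Any (_∈ X) vs
  meets {X} ¬avoids =
    Any.map (decidable-stable (_ Subsetₚ.∈? X)) (Allₚ.¬All⇒Any¬ (λ v → ¬? (v Subsetₚ.∈? X)) vs ¬avoids)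
  removed≤ : length removed ℕ.≤ length vs * n ^ j
  removed≤ = length-≤-cover (λ X v → v Subsetₚ.∈? X)
    (λ v ys! sizes′ v∈ → length-containing j v ys! (All.zip (sizes′ , v∈)))
    vs (Uniqueₚ.filter⁺ _ L!) (Allₚ.filter⁺ _ sizes) (All.map meets (Allₚ.all-filter _ L))

Triple : ℕ → Set
Triple n = Fin n × Subset n × Subset n

tripleUnion : Triple n → Subset n
tripleUnion (z , X , Y) = (X ∪ Y) ∪ ⁅ z ⁆

length-tripleUnion⁻¹ : ∀ (Z : Subset n) {ts} → Unique ts → All (λ t → tripleUnion t ≡ Z) ts →
                       length ts ℕ.≤ 2 ^ (∣ Z ∣ + (∣ Z ∣ + ∣ Z ∣))
length-tripleUnion⁻¹ {n} Z {ts} ts! unions = begin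
  length ts                  ≡⟨ sym (length-map encode ts) ⟩
  length (map encode ts)     ≤⟨ length-subsets (Z ++ (Z ++ Z)) (Uniqueₚ.map⁺ encode-injective ts!)
                                  (Allₚ.map⁺ (All.map encode⊆ unions)) ⟩
  2 ^ ∣ Z ++ (Z ++ Z) ∣       ≡⟨ cong (2 ^_) (trans (∣p++q∣≡∣p∣+∣q∣ Z (Z ++ Z))
                                                     (cong (∣ Z ∣ +_) (∣p++q∣≡∣p∣+∣q∣ Z Z))) ⟩
  2 ^ (∣ Z ∣ + (∣ Z ∣ + ∣ Z ∣)) ∎
  where
  open ℕₚ.≤-Reasoning
  encode : Triple n → Subset (n + (n + n))
  encode (z , X , Y) = ⁅ z ⁆ ++ (X ++ Y)
  encode-injective : ∀ {s t} → encode s ≡ encode t → s ≡ t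
  encode-injective {z , X , Y} {z′ , X′ , Y′} eq with Vecₚ.++-injective ⁅ z ⁆ ⁅ z′ ⁆ eq
  ... | ⁅z⁆≡ , rest with Vecₚ.++-injective X X′ rest
  ... | refl , refl rewrite ⁅⁆-injective ⁅z⁆≡ = refl
  encode⊆ : ∀ {t} → tripleUnion t ≡ Z → encode t ⊆ Z ++ (Z ++ Z)
  encode⊆ {z , X , Y} refl = ++-mono-⊆ (Subsetₚ.q⊆p∪q (X ∪ Y) ⁅ z ⁆)
    (++-mono-⊆ (Subsetₚ.⊆-trans (Subsetₚ.p⊆p∪q Y) (Subsetₚ.p⊆p∪q ⁅ z ⁆))
               (Subsetₚ.⊆-trans (Subsetₚ.q⊆p∪q X Y) (Subsetₚ.p⊆p∪q ⁅ z ⁆)))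

module _ (ord : Bool) {h n : ℕ} (H : Graph h) (G : Graph n) where

  Absorbing : Fin n → Fin n → ℕ → Subset n → Set
  Absorbing u w k X = ∣ X ∣ ≡ k × Absorbs ord H G u w X

  absorbing-∪ : ∀ {x y z a b} {X Y : Subset n} → x ≢ z → y ≢ z →
                Disjoint X Y → z ∉ X → z ∉ Y → x ∉ Y → y ∉ X →
                Absorbing x z a X → Absorbing y z b Y → Absorbing x y (suc (a + b)) (tripleUnion (z , X , Y))
  absorbing-∪ {x} {y} {z} {a} {b} {X} {Y} x≢z y≢z X∩Y z∉X z∉Y x∉Y y∉X (∣X∣≡a , Xx , Xz) (∣Y∣≡b , Yy , Yz) =
    size , tiling-x , tiling-y
    where
    open ≡-Reasoning
    size : ∣ (X ∪ Y) ∪ ⁅ z ⁆ ∣ ≡ suc (a + b)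
    size = begin
      ∣ (X ∪ Y) ∪ ⁅ z ⁆ ∣ ≡⟨ ∣p∪q∣≡∣p∣+∣q∣ (X ∪ Y) ⁅ z ⁆ (Disjoint-∪ˡ (Disjoint-⁅⁆ʳ z∉X) (Disjoint-⁅⁆ʳ z∉Y)) ⟩
      ∣ X ∪ Y ∣ + ∣ ⁅ z ⁆ ∣ ≡⟨ cong₂ _+_ (∣p∪q∣≡∣p∣+∣q∣ X Y X∩Y) (Subsetₚ.∣⁅x⁆∣≡1 z) ⟩
      ∣ X ∣ + ∣ Y ∣ + 1    ≡⟨ cong (_+ 1) (cong₂ _+_ ∣X∣≡a ∣Y∣≡b) ⟩
      a + b + 1            ≡⟨ ℕₚ.+-comm (a + b) 1 ⟩
      suc (a + b)          ∎
    tiling-x : HasPerfectTiling ord H G (((X ∪ Y) ∪ ⁅ z ⁆) ∪ ⁅ x ⁆)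
    tiling-x = subst (HasPerfectTiling ord H G) (sym ([X∪Y∪u]∪w≡[X∪w]∪[Y∪u] X Y ⁅ z ⁆ ⁅ x ⁆))
      (tiling-∪ H G (Disjoint-∪ˡ (Disjoint-∪ʳ X∩Y (Disjoint-⁅⁆ʳ z∉X))
                                  (Disjoint-∪ʳ (Disjoint-⁅⁆ˡ x∉Y) (Disjoint-⁅⁆⁅⁆ x≢z)))
                Xx Yz)
    tiling-y : HasPerfectTiling ord H G (((X ∪ Y) ∪ ⁅ z ⁆) ∪ ⁅ y ⁆)
    tiling-y = subst (HasPerfectTiling ord H G) (sym ([X∪Y∪u]∪w≡[X∪u]∪[Y∪w] X Y ⁅ z ⁆ ⁅ y ⁆))
      (tiling-∪ H G (Disjoint-∪ˡ (Disjoint-∪ʳ X∩Y (Disjoint-⁅⁆ʳ y∉X))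
                                  (Disjoint-∪ʳ (Disjoint-⁅⁆ˡ z∉Y) (Disjoint-⁅⁆⁅⁆ (y≢z ∘ sym))))
                Xz Yy)

  record Abundant (R : ℕ) (u w : Fin n) (k : ℕ) (L : List (Subset n)) : Set where
    field
      unique    : Unique L
      absorbing : All (Absorbing u w k) L
      large     : n ^ k ℕ.≤ R * length L

  AtLeastℚ⇒Abundant : ∀ {u w} β R k → (∀ m N → β ℚ.* ℕ→ℚ m ≤ ℕ→ℚ N → m ℕ.≤ R * N) →
                      AtLeastℚ (β ℚ.* ℕ→ℚ (n ^ k)) k (Absorbs ord H G u w) → Σ (List (Subset n)) (Abundant R u w k)
  AtLeastℚ⇒Abundant β R k β-scale (N , βn^k≤N , L , L! , L-absorbing , N≤L) =
    L , record { unique = L! ; absorbing = L-absorbing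
               ; large = ℕₚ.≤-trans (β-scale (n ^ k) N βn^k≤N) (ℕₚ.*-monoʳ-≤ R N≤L) }

  module _ {x y : Fin n} {A : Subset n} (x∉A : x ∉ A) (y∉A : y ∉ A) {a b R : ℕ}
           {𝒳 𝒴 : Fin n → List (Subset n)}
           (𝒳-abundant : ∀ {z} → z ∈ A → Abundant R x z a (𝒳 z))
           (𝒴-abundant : ∀ {z} → z ∈ A → Abundant R y z b (𝒴 z))
           (n-large : 2 * R * (2 + a) ℕ.≤ n) where

    private
      K : ℕ
      K = suc (a + b)

      𝒳′ : Fin n → List (Subset n)
      𝒳′ z = avoiding (y ∷ z ∷ []) (𝒳 z)

      𝒴′ : Fin n → Subset n → List (Subset n)
      𝒴′ z X = avoiding (x ∷ z ∷ elements X) (𝒴 z)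

      pairs : Fin n → List (Subset n × Subset n)
      pairs z = dependentProduct (𝒳′ z) (𝒴′ z)

      triples : List (Triple n)
      triples = dependentProduct (elements A) pairs

      ∉A⇒≢ : ∀ {u z} → u ∉ A → z ∈ A → u ≢ z
      ∉A⇒≢ u∉A z∈A refl = u∉A z∈A

      unique-triples : Unique triples
      unique-triples = unique-dependentProduct (unique-elements A) (All.map unique-pairs (elements⊆ A))
        where
        unique-pairs : ∀ {z} → z ∈ A → Unique (pairs z)
        unique-pairs z∈A = unique-dependentProduct (Uniqueₚ.filter⁺ _ (Abundant.unique (𝒳-abundant z∈A)))
          (All.universal (λ _ → Uniqueₚ.filter⁺ _ (Abundant.unique (𝒴-abundant z∈A))) _)

      triples-absorbing : All (Absorbing x y K ∘ tripleUnion) triples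
      triples-absorbing = dependentProduct⁺ (All.map pairs-absorbing (elements⊆ A))
        where
        pairs-absorbing : ∀ {z} → z ∈ A → All (λ (X , Y) → Absorbing x y K (tripleUnion (z , X , Y))) (pairs z)
        pairs-absorbing z∈A = dependentProduct⁺ (All.map
          (λ { (absX , y∉X ∷ z∉X ∷ []) → All.map
            (λ { (absY , x∉Y ∷ z∉Y ∷ X-avoided) →
                   absorbing-∪ (∉A⇒≢ x∉A z∈A) (∉A⇒≢ y∉A z∈A) (All.lookup X-avoided ∘ ∈-elements)
                               z∉X z∉Y x∉Y y∉X absX absY })
            (avoiding⁺ _ (Abundant.absorbing (𝒴-abundant z∈A))) })
          (avoiding⁺ _ (Abundant.absorbing (𝒳-abundant z∈A))))

      length-pairs : ∀ {z} → z ∈ A → n ^ (a + b) ℕ.≤ 2 * R * (2 * R) * length (pairs z)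
      length-pairs {z} z∈A = begin
        n ^ (a + b)                            ≡⟨ ℕₚ.^-distribˡ-+-* n a b ⟩
        n ^ a * n ^ b                          ≤⟨ ℕₚ.*-monoˡ-≤ (n ^ b) 𝒳′-large ⟩
        2 * R * length (𝒳′ z) * n ^ b          ≡⟨ ℕₚ.*-assoc (2 * R) (length (𝒳′ z)) (n ^ b) ⟩
        2 * R * (length (𝒳′ z) * n ^ b)        ≤⟨ ℕₚ.*-monoʳ-≤ (2 * R) (length-dependentProduct _ _ (2 * R) 𝒴′-large) ⟩
        2 * R * (2 * R * length (pairs z))     ≡⟨ sym (ℕₚ.*-assoc (2 * R) (2 * R) _) ⟩
        2 * R * (2 * R) * length (pairs z)     ∎
        where
        open ℕₚ.≤-Reasoning
        module 𝒳z = Abundant (𝒳-abundant z∈A)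
        module 𝒴z = Abundant (𝒴-abundant z∈A)
        𝒳-sizes = All.map proj₁ 𝒳z.absorbing
        𝒳′-large : n ^ a ℕ.≤ 2 * R * length (𝒳′ z)
        𝒳′-large = length-avoiding R (y ∷ z ∷ []) 𝒳z.unique 𝒳-sizes 𝒳z.large
          (ℕₚ.≤-trans (ℕₚ.*-monoʳ-≤ (2 * R) (ℕₚ.m≤m+n 2 a)) n-large)
        𝒴′-large : All (λ X → n ^ b ℕ.≤ 2 * R * length (𝒴′ z X)) (𝒳′ z)
        𝒴′-large = All.map (λ {X} ∣X∣≡a → length-avoiding R (x ∷ z ∷ elements X) 𝒴z.unique
                              (All.map proj₁ 𝒴z.absorbing) 𝒴z.large
                              (subst (λ k → 2 * R * (2 + k) ℕ.≤ n) (sym (trans (length-elements X) ∣X∣≡a)) n-large))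
                           (Allₚ.filter⁺ _ 𝒳-sizes)

      length-triples : ∣ A ∣ * n ^ (a + b) ℕ.≤ 2 * R * (2 * R) * length triples
      length-triples = subst (λ k → k * n ^ (a + b) ℕ.≤ 2 * R * (2 * R) * length triples) (length-elements A)
        (length-dependentProduct (elements A) pairs (2 * R * (2 * R)) (All.map length-pairs (elements⊆ A)))

      fibre : ∀ (Z : Subset n) {ts} → Unique ts → All (λ t → ∣ tripleUnion t ∣ ≡ K) ts →
              All (λ t → tripleUnion t ≡ Z) ts → length ts ℕ.≤ 2 ^ (K + (K + K))
      fibre Z {[]} _ _ _ = z≤n
      fibre Z {t ∷ ts} ts! (∣t∣≡K ∷ _) unions@(t≡Z ∷ _) =
        subst (λ k → length (t ∷ ts) ℕ.≤ 2 ^ (k + (k + k))) (trans (cong ∣_∣ (sym t≡Z)) ∣t∣≡K)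
              (length-tripleUnion⁻¹ Z ts! unions)

    xy-absorbers : Σ (List (Subset n)) λ Zs → Unique Zs × All (Absorbing x y K) Zs ×
                   ∣ A ∣ * n ^ (a + b) ℕ.≤ 2 * R * (2 * R) * 2 ^ (K + (K + K)) * length Zs
    xy-absorbers =
      Zs , DecUniqueₚ.deduplicate-! _≟_ unions , Allₚ.deduplicate⁺ _≟_ (Allₚ.map⁺ triples-absorbing) , (begin
      ∣ A ∣ * n ^ (a + b)                                 ≤⟨ length-triples ⟩
      2 * R * (2 * R) * length triples                    ≤⟨ ℕₚ.*-monoʳ-≤ (2 * R * (2 * R)) triples≤ ⟩
      2 * R * (2 * R) * (length Zs * M)                   ≡⟨ cong (2 * R * (2 * R) *_) (ℕₚ.*-comm (length Zs) M) ⟩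
      2 * R * (2 * R) * (M * length Zs)                   ≡⟨ sym (ℕₚ.*-assoc (2 * R * (2 * R)) M (length Zs)) ⟩
      2 * R * (2 * R) * M * length Zs                     ∎)
      where
      open ℕₚ.≤-Reasoning
      M = 2 ^ (K + (K + K))
      _≟_ : DecidableEquality (Subset n)
      _≟_ = Vecₚ.≡-dec Boolₚ._≟_
      unions = map tripleUnion triples
      Zs = deduplicate _≟_ unions
      triples≤ : length triples ℕ.≤ length Zs * M
      triples≤ = length-≤-cover (λ t Z → tripleUnion t ≟ Z) fibre Zs unique-triples
        (All.map proj₁ triples-absorbing) (All.tabulate (∈-deduplicate⁺ _≟_ ∘ ∈-map⁺ tripleUnion))

m≤qa∧ap≤cz⇒mp≤[1+qc]z : ∀ {m p a z} q c → m ℕ.≤ q * a → a * p ℕ.≤ c * z → m * p ℕ.≤ suc (q * c) * z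
m≤qa∧ap≤cz⇒mp≤[1+qc]z {m} {p} {a} {z} q c m≤qa ap≤cz = begin
  m * p         ≤⟨ ℕₚ.*-monoˡ-≤ p m≤qa ⟩
  q * a * p     ≡⟨ ℕₚ.*-assoc q a p ⟩
  q * (a * p)   ≤⟨ ℕₚ.*-monoʳ-≤ q ap≤cz ⟩
  q * (c * z)   ≡⟨ sym (ℕₚ.*-assoc q c z) ⟩
  q * c * z     ≤⟨ ℕₚ.*-monoˡ-≤ z (ℕₚ.n≤1+n (q * c)) ⟩
  suc (q * c) * z ∎
  where open ℕₚ.≤-Reasoning

suc[m∸1+n∸1]≡m+n∸1 : ∀ {m n} → 1 ℕ.≤ m → 1 ℕ.≤ n → suc ((m ∸ 1) + (n ∸ 1)) ≡ m + n ∸ 1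
suc[m∸1+n∸1]≡m+n∸1 {suc m} {suc n} _ _ = sym (ℕₚ.+-suc m n)

-- Rational bounds

ℕ→ℚ≡mkℚ : ∀ k → ℕ→ℚ k ≡ mkℚ (ℤ.+ k) 0 (coprime-sym (1-coprimeTo k))
ℕ→ℚ≡mkℚ k = ℚₚ.normalize-coprime (coprime-sym (1-coprimeTo k))

mkℚ*ℕ→ℚ≤ℕ→ℚ⇔ : ∀ i d .(c : Coprime ℤ.∣ i ∣ (suc d)) m k →
  (mkℚ i d c ℚ.* ℕ→ℚ m ≤ ℕ→ℚ k) ⇔ (i ℤ.* ℤ.+ m ℤ.≤ ℤ.+ (suc d * k))
mkℚ*ℕ→ℚ≤ℕ→ℚ⇔ i d c m k rewrite ℕ→ℚ≡mkℚ m | ℕ→ℚ≡mkℚ k = mk⇔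
  (λ α*m≤k → subst₂ ℤ._≤_ lhs rhs (ℚᵘₚ.drop-*≤* (ℚᵘₚ.≤-respˡ-≃ homo (ℚₚ.toℚᵘ-mono-≤ α*m≤k))))
  (λ im≤dk → ℚₚ.toℚᵘ-cancel-≤ (ℚᵘₚ.≤-respˡ-≃ (ℚᵘₚ.≃-sym homo) (ℚᵘ.*≤* (subst₂ ℤ._≤_ (sym lhs) (sym rhs) im≤dk))))
  where
  homo = ℚₚ.toℚᵘ-homo-* (mkℚ i d c) (mkℚ (ℤ.+ m) 0 (coprime-sym (1-coprimeTo m)))
  lhs : (i ℤ.* ℤ.+ m) ℤ.* ℤ.+ 1 ≡ i ℤ.* ℤ.+ m
  lhs = ℤₚ.*-identityʳ _
  rhs : ℤ.+ k ℤ.* ℤ.+ (suc d * 1) ≡ ℤ.+ (suc d * k)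
  rhs = trans (sym (ℤₚ.pos-* k _)) (cong ℤ.+_ (trans (cong (k *_) (ℕₚ.*-identityʳ (suc d))) (ℕₚ.*-comm k (suc d))))

-- Writing α = (p + 1)/(d + 1), the hypothesis reads (p + 1) m ≤ (d + 1) k.
positive⇒ℕ-scale : ∀ {α} → 0ℚ < α → ∃ λ Q → ∀ m k → α ℚ.* ℕ→ℚ m ≤ ℕ→ℚ k → m ℕ.≤ Q * k
positive⇒ℕ-scale {mkℚ (ℤ.+ zero) d c} (*<* (ℤ.+<+ ()))
positive⇒ℕ-scale {mkℚ ℤ.-[1+ p ] d c} (*<* ())
positive⇒ℕ-scale {mkℚ (ℤ.+ suc p) d c} _ = suc d , λ m k α*m≤k → ℕₚ.≤-trans (ℕₚ.m≤n*m m (suc p))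
  (ℤₚ.drop‿+≤+ (subst (ℤ._≤ _) (sym (ℤₚ.pos-* (suc p) m)) (Equivalence.to (mkℚ*ℕ→ℚ≤ℕ→ℚ⇔ _ d c m k) α*m≤k)))

1/[1+_] : ℕ → ℚ
1/[1+ D ] = mkℚ (ℤ.+ 1) D (1-coprimeTo (suc D))

1/[1+n]-positive : ∀ D → 0ℚ < 1/[1+ D ]
1/[1+n]-positive D = *<* (ℤ.+<+ (s≤s z≤n))

≤1/[1+D]⇒*≤ : ∀ {γ} D {m N} → γ ≤ 1/[1+ D ] → m ℕ.≤ suc D * N → γ ℚ.* ℕ→ℚ m ≤ ℕ→ℚ N
≤1/[1+D]⇒*≤ {γ} D {m} {N} γ≤ m≤ rewrite ℕ→ℚ≡mkℚ m = ℚₚ.≤-trans (ℚₚ.*-monoʳ-≤-nonNeg (mkℚ (ℤ.+ m) 0 _) γ≤)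
  (subst (λ q → 1/[1+ D ] ℚ.* q ≤ ℕ→ℚ N) (ℕ→ℚ≡mkℚ m)
    (Equivalence.from (mkℚ*ℕ→ℚ≤ℕ→ℚ⇔ (ℤ.+ 1) D _ m N) (subst (ℤ._≤ _) (sym (ℤₚ.*-identityˡ (ℤ.+ m))) (ℤ.+≤+ m≤))))

lemma7p2 : (ordered : Bool) (α β : ℚ) → 0ℚ < α → 0ℚ < β →
    (h s₁ s₂ : ℕ) → 1 ℕ.≤ h → 1 ℕ.≤ s₁ → 1 ℕ.≤ s₂ →
    Σ ℚ λ γ₀ → 0ℚ < γ₀ × ((γ : ℚ) → 0ℚ < γ → γ ≤ γ₀ →
      Σ ℕ λ n₀ → (n : ℕ) → n₀ ℕ.≤ n →
        (H : Graph h) (G : Graph n) (x y : Fin n) (A : Subset n) →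
        x ∉ A → y ∉ A → α ℚ.* ℕ→ℚ n ≤ ℕ→ℚ ∣ A ∣ →
        (∀ z → z ∈ A →
          AtLeastℚ (β ℚ.* ℕ→ℚ (n ^ (s₁ * h ∸ 1))) (s₁ * h ∸ 1) (Absorbs ordered H G x z)
          × AtLeastℚ (β ℚ.* ℕ→ℚ (n ^ (s₂ * h ∸ 1))) (s₂ * h ∸ 1) (Absorbs ordered H G y z)) →
        AtLeastℚ (γ ℚ.* ℕ→ℚ (n ^ ((s₁ + s₂) * h ∸ 1))) ((s₁ + s₂) * h ∸ 1) (Absorbs ordered H G x y))
lemma7p2 ord α β 0<α 0<β h s₁ s₂ 1≤h 1≤s₁ 1≤s₂ = 1/[1+ Q * C ] , 1/[1+n]-positive (Q * C) , λ γ _ γ≤γ₀ →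
  2 * R * (2 + a) , λ n n-large H G x y A x∉A y∉A A-large families →
    let 𝒳 = choose (Subsetₚ._∈? A) [] (λ z z∈A → AtLeastℚ⇒Abundant ord H G β R a β-scale (proj₁ (families z z∈A)))
        𝒴 = choose (Subsetₚ._∈? A) [] (λ z z∈A → AtLeastℚ⇒Abundant ord H G β R b β-scale (proj₂ (families z z∈A)))
        (Zs , Zs! , Zs-absorbing , count) = xy-absorbers ord H G x∉A y∉A (proj₂ 𝒳) (proj₂ 𝒴) n-large
    in subst (λ k → AtLeastℚ (γ ℚ.* ℕ→ℚ (n ^ k)) k (Absorbs ord H G x y)) K≡
         (length Zs , ≤1/[1+D]⇒*≤ (Q * C) γ≤γ₀ (m≤qa∧ap≤cz⇒mp≤[1+qc]z Q C (α-scale n ∣ A ∣ A-large) count) ,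
          Zs , Zs! , Zs-absorbing , ℕₚ.≤-refl)
  where
  Q = proj₁ (positive⇒ℕ-scale 0<α)
  α-scale = proj₂ (positive⇒ℕ-scale 0<α)
  R = proj₁ (positive⇒ℕ-scale 0<β)
  β-scale = proj₂ (positive⇒ℕ-scale 0<β)
  a = s₁ * h ∸ 1
  b = s₂ * h ∸ 1
  K = suc (a + b)
  C = 2 * R * (2 * R) * 2 ^ (K + (K + K))

  K≡ : K ≡ (s₁ + s₂) * h ∸ 1
  K≡ = trans (suc[m∸1+n∸1]≡m+n∸1 (ℕₚ.*-mono-≤ 1≤s₁ 1≤h) (ℕₚ.*-mono-≤ 1≤s₂ 1≤h))
             (cong (_∸ 1) (sym (ℕₚ.*-distribʳ-+ h s₁ s₂)))
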